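{- Let $\emptyset\neq A\subseteq\mathrm{Ag}$ and let $\mathsf{L}_1,\mathsf{L}_2$ be multi-agent logics with recursion such that $\mathsf{L}_1(\alpha)=\mathsf{L}_2(\alpha)+T$ when $\alpha\in A$ and $\mathsf{L}_1(\alpha)=\mathsf{L}_2(\alpha)$ otherwise, and each $\mathsf{L}_2(\alpha)$ includes at most the frame condition $D$. Define the translation $\tau$ on formulas by $\tau([\alpha]\varphi)=[\alpha]\tau(\varphi)\wedge\tau(\varphi)$ and $\tau(\langle\alpha\rangle\varphi)=\langle\alpha\rangle\tau(\varphi)\vee\tau(\varphi)$ for $\alpha\in A$, with $\tau$ commuting with all other operations (including $[\beta],\langle\beta\rangle$ for $\beta\notin A$, Boolean connectives and fixed-point operators). Then a formula $\varphi$ is $\mathsf{L}_1$-satisfiable if and only if $\tau(\varphi)$ is $\mathsf{L}_2$-satisfiable.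
   Context: Formulas are built by $\varphi::=p\mid\neg p\mid\mathtt{tt}\mid\mathtt{ff}\mid X\mid\varphi\wedge\varphi\mid\varphi\vee\varphi\mid\langle\alpha\rangle\varphi\mid[\alpha]\varphi\mid\mu X.\varphi\mid\nu X.\varphi$, with $p$ from a finite set of propositional variables, $X$ from a countable set of fixed-point variables, $\alpha$ from a finite set $\mathrm{Ag}$ of agents; only closed formulas are considered. They are interpreted on Kripke models $(W,R,V)$, $R\subseteq W\times\mathrm{Ag}\times W$, with the standard modal $\mu$-calculus semantics. Frame conditions on $R_\alpha$: $D$ serial, $T$ reflexive. A multi-agent logic $\mathsf{L}$ assigns to each agent $\alpha$ a single-agent logic $\mathsf{L}(\alpha)$ (i.e. $\mathsf{K}$ plus a set of frame conditions); $\mathsf{L}(\alpha)+T$ adds reflexivity. Models of $\mathsf{L}$ are Kripke models in which each $R_\alpha$ satisfies the conditions of $\mathsf{L}(\alpha)$; a formula is $\mathsf{L}$-satisfiable if it holds at some state of some model of $\mathsf{L}$. -}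

module Defs where

open import Level using (Level; Lift; lift) renaming (suc to lsuc; zero to lzero)
open import Data.Nat using (ℕ; suc)
open import Data.Fin using (Fin; zero; suc)
open import Data.Fin.Subset using (Subset; _∈_; _∉_; Nonempty)
open import Data.Fin.Subset.Properties using (_∈?_)
open import Data.Bool using (Bool; true; false)
open import Data.Product using (Σ; _×_; _,_; ∃)
open import Data.Sum using (_⊎_)
open import Data.Unit.Polymorphic using (⊤)
open import Data.Empty.Polymorphic using (⊥)
open import Relation.Nullary using (¬_; yes; no)
open import Relation.Binary.PropositionalEquality using (_≡_)

-- Modal mu-calculus formulas over np propositional variables and na agents,
-- with fixed-point variables in de Bruijn style: Form np na n has at most
-- n free fixed-point variables.
data Form (np na : ℕ) : ℕ → Set where
  prop  : ∀ {n} → Fin np → Form np na n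
  nprop : ∀ {n} → Fin np → Form np na n
  tt ff : ∀ {n} → Form np na n
  fvar  : ∀ {n} → Fin n → Form np na n
  _∧′_ _∨′_ : ∀ {n} → Form np na n → Form np na n → Form np na n
  dia box : ∀ {n} → Fin na → Form np na n → Form np na n
  mu nu : ∀ {n} → Form np na (suc n) → Form np na n

record Model (np na : ℕ) : Set₁ where
  field
    W : Set
    R : Fin na → W → W → Set
    V : Fin np → W → Set
open Model public

extend : ∀ {n} {W : Set} → (W → Set) → (Fin n → W → Set) → Fin (suc n) → W → Set
extend S ρ zero = S
extend S ρ (suc i) = ρ i

-- Standard semantics; fixed points via Knaster–Tarski:
--   mu = intersection of all pre-fixed points, nu = union of all post-fixed points.
⟦_⟧ : ∀ {np na n} → Form np na n → (M : Model np na) → (Fin n → W M → Set) → W M → Set₁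
⟦ prop p ⟧ M ρ w = Lift (lsuc lzero) (V M p w)
⟦ nprop p ⟧ M ρ w = Lift (lsuc lzero) (¬ V M p w)
⟦ tt ⟧ M ρ w = ⊤ {lsuc lzero}
⟦ ff ⟧ M ρ w = ⊥ {lsuc lzero}
⟦ fvar i ⟧ M ρ w = Lift (lsuc lzero) (ρ i w)
⟦ φ ∧′ ψ ⟧ M ρ w = ⟦ φ ⟧ M ρ w × ⟦ ψ ⟧ M ρ w
⟦ φ ∨′ ψ ⟧ M ρ w = ⟦ φ ⟧ M ρ w ⊎ ⟦ ψ ⟧ M ρ w
⟦ dia a φ ⟧ M ρ w = Σ (W M) λ v → Lift (lsuc lzero) (R M a w v) × ⟦ φ ⟧ M ρ v
⟦ box a φ ⟧ M ρ w = ∀ v → R M a w v → ⟦ φ ⟧ M ρ v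
⟦ mu φ ⟧ M ρ w = ∀ (S : W M → Set) → (∀ v → ⟦ φ ⟧ M (extend S ρ) v → S v) → Lift (lsuc lzero) (S w)
⟦ nu φ ⟧ M ρ w = Σ (W M → Set) λ S → (∀ v → S v → ⟦ φ ⟧ M (extend S ρ) v) × Lift (lsuc lzero) (S w)

emptyEnv : {W : Set} → Fin 0 → W → Set
emptyEnv ()

data FrameCond : Set where
  D T : FrameCond

-- A single-agent logic: K plus the set of frame conditions c with L c ≡ true.
SingleLogic : Set
SingleLogic = FrameCond → Bool

addT : SingleLogic → SingleLogic
addT L D = L D
addT L T = true

MultiLogic : ℕ → Set
MultiLogic na = Fin na → SingleLogic

Serial : {W : Set} → (W → W → Set) → Set
Serial {W} R = ∀ w → Σ W λ v → R w v

Reflexive : {W : Set} → (W → W → Set) → Set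
Reflexive {W} R = ∀ w → R w w

Satisfies : {W : Set} → (W → W → Set) → FrameCond → Set
Satisfies R D = Serial R
Satisfies R T = Reflexive R

IsModelOf : ∀ {np na} → MultiLogic na → Model np na → Set
IsModelOf L M = ∀ a c → L a c ≡ true → Satisfies (R M a) c

Satisfiable : ∀ {np na} → MultiLogic na → Form np na 0 → Set₁
Satisfiable {np} {na} L φ =
  Σ (Model np na) λ M → IsModelOf L M × Σ (W M) λ w → ⟦ φ ⟧ M emptyEnv w

τ : ∀ {np na n} → Subset na → Form np na n → Form np na n
τ A (prop p) = prop p
τ A (nprop p) = nprop p
τ A tt = tt
τ A ff = ff
τ A (fvar i) = fvar i
τ A (φ ∧′ ψ) = τ A φ ∧′ τ A ψ
τ A (φ ∨′ ψ) = τ A φ ∨′ τ A ψ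
τ A (dia a φ) with a ∈? A
... | yes _ = dia a (τ A φ) ∨′ τ A φ
... | no _  = dia a (τ A φ)
τ A (box a φ) with a ∈? A
... | yes _ = box a (τ A φ) ∧′ τ A φ
... | no _  = box a (τ A φ)
τ A (mu φ) = mu (τ A φ)
τ A (nu φ) = nu (τ A φ)

{-# OPTIONS --safe #-}
module Submission where

-- In an L₁-model every R_α with α ∈ A is reflexive, so there [α]φ is
-- equivalent to [α]φ ∧ φ and ⟨α⟩φ to ⟨α⟩φ ∨ φ: the model itself satisfies
-- τ(φ), and it is an L₂-model since L₂ only drops conditions. Conversely,
-- adding the diagonal to every R_α with α ∈ A turns an L₂-model into an
-- L₁-model (reflexivity implies seriality, and both conditions survive
-- enlarging a relation), and φ holds in the new model exactly where τ(φ)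
-- holds in the old one.

open import Defs
open import Data.Nat using (ℕ)
open import Data.Fin using (Fin)
open import Data.Fin.Subset using (Subset; _∈_; _∉_; Nonempty)
open import Data.Fin.Subset.Properties using (_∈?_)
open import Data.Bool using (true; false)
open import Data.Product using (_×_; _,_)
open import Data.Product.Function.NonDependent.Propositional using (_×-⇔_)
open import Data.Sum using (_⊎_; inj₁; inj₂; [_,_])
open import Data.Sum.Function.Propositional using (_⊎-⇔_)
open import Relation.Nullary using (yes; no; contradiction)
open import Relation.Binary.PropositionalEquality using (_≡_; refl; sym; trans)
open import Level using (lift)
open import Function using (id)
open import Function.Bundles using (_⇔_; mk⇔; Equivalence)
open import Function.Construct.Identity using (⇔-id)

open Equivalence using (to; from)

Satisfies-mono : ∀ {W : Set} {R R′ : W → W → Set} →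
  (∀ {w v} → R w v → R′ w v) → ∀ c → Satisfies R c → Satisfies R′ c
Satisfies-mono R⊆R′ D serial w with serial w
... | v , r = v , R⊆R′ r
Satisfies-mono R⊆R′ T reflexive w = R⊆R′ (reflexive w)

reflexive⇒Satisfies : ∀ {W : Set} {R : W → W → Set} → Reflexive R → ∀ c → Satisfies R c
reflexive⇒Satisfies reflexive D w = w , reflexive w
reflexive⇒Satisfies reflexive T = reflexive

isModelOf-antitone : ∀ {np na} {L L′ : MultiLogic na} {M : Model np na} →
  (∀ a c → L a c ≡ true → L′ a c ≡ true) → IsModelOf L′ M → IsModelOf L M
isModelOf-antitone L⊆L′ isModel a c Lac = isModel a c (L⊆L′ a c Lac)

addT-extends : ∀ (L : SingleLogic) c → L c ≡ true → addT L c ≡ true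
addT-extends L D Lc = Lc
addT-extends L T Lc = refl

withRelations : ∀ {np na} (M : Model np na) → (Fin na → W M → W M → Set) → Model np na
withRelations M R′ = record { W = W M ; R = R′ ; V = V M }

reflClosureOn : ∀ {na} {W : Set} → Subset na → (Fin na → W → W → Set) → Fin na → W → W → Set
reflClosureOn A R a w v = R a w v ⊎ (a ∈ A × w ≡ v)

reflClosureOn-isModelOf : ∀ {np na} (A : Subset na) {L₁ L₂ : MultiLogic na} {M : Model np na} →
  (∀ a → a ∉ A → ∀ c → L₁ a c ≡ L₂ a c) →
  IsModelOf L₂ M → IsModelOf L₁ (withRelations M (reflClosureOn A (R M)))
reflClosureOn-isModelOf A L₁-outside isModel a c L₁ac with a ∈? A
... | yes a∈A = reflexive⇒Satisfies (λ _ → inj₂ (a∈A , refl)) c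
... | no a∉A  = Satisfies-mono inj₁ c (isModel a c (trans (sym (L₁-outside a a∉A c)) L₁ac))

record IsReflClosureOn {na} {W : Set} (A : Subset na) (R R′ : Fin na → W → W → Set) : Set where
  field
    inside  : ∀ {a} → a ∈ A → ∀ {w v} → R′ a w v ⇔ (R a w v ⊎ w ≡ v)
    outside : ∀ {a} → a ∉ A → ∀ {w v} → R′ a w v ⇔ R a w v

reflClosureOn-isReflClosureOn : ∀ {na} {W : Set} (A : Subset na) (R : Fin na → W → W → Set) →
  IsReflClosureOn A R (reflClosureOn A R)
reflClosureOn-isReflClosureOn A R = record
  { inside  = λ a∈A → mk⇔ [ inj₁ , (λ { (_ , w≡v) → inj₂ w≡v }) ]
                          [ inj₁ , (λ w≡v → inj₂ (a∈A , w≡v)) ]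
  ; outside = λ a∉A → mk⇔ [ id , (λ { (a∈A , _) → contradiction a∈A a∉A }) ] inj₁
  }

reflexiveOn⇒isReflClosureOn : ∀ {na} {W : Set} (A : Subset na) (R : Fin na → W → W → Set) →
  (∀ {a} → a ∈ A → Reflexive (R a)) → IsReflClosureOn A R R
reflexiveOn⇒isReflClosureOn A R reflexive = record
  { inside  = λ a∈A → mk⇔ inj₁ [ id , (λ { refl → reflexive a∈A _ }) ]
  ; outside = λ _ → ⇔-id _
  }

module _ {np na} (A : Subset na) (M : Model np na) {R′ : Fin na → W M → W M → Set}
         (closure : IsReflClosureOn A (R M) R′) where

  open IsReflClosureOn closure

  τ-correct : ∀ {n} (ψ : Form np na n) ρ w → ⟦ τ A ψ ⟧ M ρ w ⇔ ⟦ ψ ⟧ (withRelations M R′) ρ w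
  τ-correct (prop p)  ρ w = ⇔-id _
  τ-correct (nprop p) ρ w = ⇔-id _
  τ-correct tt        ρ w = ⇔-id _
  τ-correct ff        ρ w = ⇔-id _
  τ-correct (fvar i)  ρ w = ⇔-id _
  τ-correct (φ ∧′ ψ)  ρ w = τ-correct φ ρ w ×-⇔ τ-correct ψ ρ w
  τ-correct (φ ∨′ ψ)  ρ w = τ-correct φ ρ w ⊎-⇔ τ-correct ψ ρ w
  τ-correct (dia a ψ) ρ w with a ∈? A
  ... | yes a∈A = mk⇔
    (λ { (inj₁ (v , lift r , x)) → v , lift (from (inside a∈A) (inj₁ r)) , to (τ-correct ψ ρ v) x
       ; (inj₂ x) → w , lift (from (inside a∈A) (inj₂ refl)) , to (τ-correct ψ ρ w) x })
    (λ { (v , lift r′ , x) → [ (λ r → inj₁ (v , lift r , from (τ-correct ψ ρ v) x))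
                             , (λ { refl → inj₂ (from (τ-correct ψ ρ v) x) }) ]
                             (to (inside a∈A) r′) })
  ... | no a∉A = mk⇔
    (λ { (v , lift r , x) → v , lift (from (outside a∉A) r) , to (τ-correct ψ ρ v) x })
    (λ { (v , lift r′ , x) → v , lift (to (outside a∉A) r′) , from (τ-correct ψ ρ v) x })
  τ-correct (box a ψ) ρ w with a ∈? A
  ... | yes a∈A = mk⇔
    (λ { (□x , x) v r′ → to (τ-correct ψ ρ v)
           ([ □x v , (λ { refl → x }) ] (to (inside a∈A) r′)) })
    (λ □x → (λ v r → from (τ-correct ψ ρ v) (□x v (from (inside a∈A) (inj₁ r))))
          , from (τ-correct ψ ρ w) (□x w (from (inside a∈A) (inj₂ refl))))
  ... | no a∉A = mk⇔
    (λ □x v r′ → to (τ-correct ψ ρ v) (□x v (to (outside a∉A) r′)))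
    (λ □x v r → from (τ-correct ψ ρ v) (□x v (from (outside a∉A) r)))
  τ-correct (mu ψ) ρ w = mk⇔
    (λ x S pre → x S (λ v y → pre v (to (τ-correct ψ (extend S ρ) v) y)))
    (λ x S pre → x S (λ v y → pre v (from (τ-correct ψ (extend S ρ) v) y)))
  τ-correct (nu ψ) ρ w = mk⇔
    (λ { (S , post , s) → S , (λ v y → to (τ-correct ψ (extend S ρ) v) (post v y)) , s })
    (λ { (S , post , s) → S , (λ v y → from (τ-correct ψ (extend S ρ) v) (post v y)) , s })

theorem3p10 : (np na : ℕ) (A : Subset na) → Nonempty A →
    (L₁ L₂ : MultiLogic na) →
    (∀ a → a ∈ A → ∀ c → L₁ a c ≡ addT (L₂ a) c) →
    (∀ a → a ∉ A → ∀ c → L₁ a c ≡ L₂ a c) →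
    (∀ a → L₂ a T ≡ false) →
    (φ : Form np na 0) →
    Satisfiable L₁ φ ⇔ Satisfiable L₂ (τ A φ)
theorem3p10 np na A _ L₁ L₂ L₁-inside L₁-outside _ φ = mk⇔ to′ from′
  where
  L₂⊆L₁ : ∀ a c → L₂ a c ≡ true → L₁ a c ≡ true
  L₂⊆L₁ a c L₂ac with a ∈? A
  ... | yes a∈A = trans (L₁-inside a a∈A c) (addT-extends (L₂ a) c L₂ac)
  ... | no a∉A  = trans (L₁-outside a a∉A c) L₂ac

  to′ : Satisfiable L₁ φ → Satisfiable L₂ (τ A φ)
  to′ (M , isModel , w , x) =
    M , isModelOf-antitone {M = M} L₂⊆L₁ isModel , w , from (τ-correct A M closure φ emptyEnv w) x
    where
    closure : IsReflClosureOn A (R M) (R M)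
    closure = reflexiveOn⇒isReflClosureOn A (R M)
                (λ {a} a∈A → isModel a T (L₁-inside a a∈A T))

  from′ : Satisfiable L₂ (τ A φ) → Satisfiable L₁ φ
  from′ (M , isModel , w , x) =
    withRelations M R′ , reflClosureOn-isModelOf A {M = M} L₁-outside isModel ,
    w , to (τ-correct A M closure φ emptyEnv w) x
    where
    R′ : Fin na → W M → W M → Set
    R′ = reflClosureOn A (R M)

    closure : IsReflClosureOn A (R M) R′
    closure = reflClosureOn-isReflClosureOn A (R M)
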